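{- For every $n\geq 0$, the map $\varphi_n:\mathrm{Int}(\mathcal M_n^C)\to\mathcal N_n$ given by $\varphi_n(P,Q)=(X,Y)$, where $Y=P$ and for each $i\in[n]$ \[X_i=\begin{cases}U&\text{if }\overline{P}_i=d\text{ and }\overline{Q}_i=u,\\ D&\text{if }\overline{P}_i=u\text{ and }\overline{Q}_i=d,\\ E&\text{if }\overline{P}_i=\overline{Q}_i,\end{cases}\] is a well-defined bijection.
   Context: A Motzkin path of length $n$ is a word $P=P_1\cdots P_n$ in $\{U,D,E\}$ with equally many $U$'s and $D$'s such that every prefix has at least as many $U$'s as $D$'s; $M_n$ is the set of these. The height of $P$ after $i$ steps is $\#U-\#D$ in $P_1\cdots P_i$; $P\leq_S Q$ if the height of $P$ after $i$ steps is at most that of $Q$ for all $i$. The class $\mathrm{cl}(P)$ is the subsequence of $P$ consisting of its $U$'s and $E$'s. $P\leq_C Q$ if $\mathrm{cl}(P)=\mathrm{cl}(Q)$ and $P\leq_S Q$; $\mathcal M_n^C=(M_n,\leq_C)$ and $\mathrm{Int}(\mathcal M_n^C)=\{(P,Q)\in M_n^2:P\leq_C Q\}$. The support $\overline P$ of $P$ is the word in $\{u,d\}$ with $\overline P_i=u$ if $P_i\in\{U,E\}$ and $\overline P_i=d$ if $P_i=D$. $\mathcal N_n$ is the set of pairs $(X,Y)\in M_n^2$ such that for every $i\in[n]$, $(X_i,Y_i)\in\{(D,E),(D,U),(E,D),(E,E),(E,U),(U,D)\}$. -}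

module Defs where

open import Data.Nat using (ℕ; zero; suc)
open import Data.Integer using (ℤ; +_; _+_; _-_; _≤ᵇ_)
open import Data.Bool using (Bool; true; false; _∧_)
open import Data.Vec using (Vec; []; _∷_; zipWith)
open import Data.List using (List; []; _∷_)
open import Data.Unit using (⊤)
open import Data.Product using (Σ; _×_; _,_; proj₁)
open import Relation.Binary.PropositionalEquality using (_≡_)
open import Data.Bool using (T)

data Step : Set where
  U D E : Step

_≟S_ : Step → Step → Bool
U ≟S U = true
D ≟S D = true
E ≟S E = true
_ ≟S _ = false

data Supp : Set where
  u d : Supp

_≟s_ : Supp → Supp → Bool
u ≟s u = true
d ≟s d = true
_ ≟s _ = false

Word : ℕ → Set
Word n = Vec Step n

δ : Step → ℤ
δ U = + 1
δ D = Data.Integer.-_ (+ 1)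
δ E = + 0

heightsFrom : ∀ {n} → ℤ → Word n → Vec ℤ n
heightsFrom h [] = []
heightsFrom h (s ∷ w) = (h + δ s) ∷ heightsFrom (h + δ s) w

heights : ∀ {n} → Word n → Vec ℤ n
heights = heightsFrom (+ 0)

finalHeight : ∀ {n} → Word n → ℤ
finalHeight [] = + 0
finalHeight (s ∷ w) = δ s + finalHeight w

allV : ∀ {A : Set} {n} → (A → Bool) → Vec A n → Bool
allV p [] = true
allV p (x ∷ xs) = p x ∧ allV p xs

isMotzkinᵇ : ∀ {n} → Word n → Bool
isMotzkinᵇ w = allV (λ h → + 0 ≤ᵇ h) (heights w)
               ∧ ((finalHeight w ≤ᵇ + 0) ∧ (+ 0 ≤ᵇ finalHeight w))

IsMotzkin : ∀ {n} → Word n → Set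
IsMotzkin w = T (isMotzkinᵇ w)

-- M_n  (membership is a proposition, being of the form T b)
M : ℕ → Set
M n = Σ (Word n) IsMotzkin

leqSᵇ : ∀ {n} → Word n → Word n → Bool
leqSᵇ p q = allV (λ x → x) (zipWith _≤ᵇ_ (heights p) (heights q))

cl : ∀ {n} → Word n → List Step
cl [] = []
cl (U ∷ w) = U ∷ cl w
cl (D ∷ w) = cl w
cl (E ∷ w) = E ∷ cl w

eqListᵇ : List Step → List Step → Bool
eqListᵇ [] [] = true
eqListᵇ (x ∷ xs) (y ∷ ys) = (x ≟S y) ∧ eqListᵇ xs ys
eqListᵇ _ _ = false

leqCᵇ : ∀ {n} → Word n → Word n → Bool
leqCᵇ p q = eqListᵇ (cl p) (cl q) ∧ leqSᵇ p q

_≤C_ : ∀ {n} → Word n → Word n → Set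
p ≤C q = T (leqCᵇ p q)

Int : ℕ → Set
Int n = Σ (M n × M n) λ pq → proj₁ (Data.Product.proj₁ pq) ≤C proj₁ (Data.Product.proj₂ pq)

allowedᵇ : Step → Step → Bool
allowedᵇ D E = true
allowedᵇ D U = true
allowedᵇ E D = true
allowedᵇ E E = true
allowedᵇ E U = true
allowedᵇ U D = true
allowedᵇ _ _ = false

allowedWᵇ : ∀ {n} → Word n → Word n → Bool
allowedWᵇ [] [] = true
allowedWᵇ (x ∷ xs) (y ∷ ys) = allowedᵇ x y ∧ allowedWᵇ xs ys

N : ℕ → Set
N n = Σ (M n × M n) λ xy →
        T (allowedWᵇ (proj₁ (Data.Product.proj₁ xy)) (proj₁ (Data.Product.proj₂ xy)))

supp : Step → Supp
supp U = u
supp E = u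
supp D = d

xLetter : Step → Step → Step
xLetter p q with supp p | supp q
... | d | u = U
... | u | d = D
... | u | u = E
... | d | d = E

φword : ∀ {n} → Word n → Word n → Word n × Word n
φword p q = zipWith xLetter p q , p

WellDefined : ℕ → Set
WellDefined n = (pq : Int n) →
  let P = proj₁ (Data.Product.proj₁ (proj₁ pq))
      Q = proj₁ (Data.Product.proj₂ (proj₁ pq))
  in Σ (N n) λ xy →
       (proj₁ (Data.Product.proj₁ (proj₁ xy)) , proj₁ (Data.Product.proj₂ (proj₁ xy)))
         ≡ φword P Q

φ : ∀ {n} → WellDefined n → Int n → N n
φ wd pq = proj₁ (wd pq)

-- Since cl P = cl Q, both paths read the same class word c, one letter
-- at each of their non-D steps.  Walking along both paths, let the queue β be
-- the letters that Q has already read but P has not.  Then, at every time,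
--   (i)   the unread class of P is β followed by the unread class of Q,
--   (ii)  height(Q) − height(P) = weight β   (a U weighs 2, an E weighs 1),
--   (iii) height(X) = length β.
-- A pair of steps (s,t) updates the queue by β ++ letters t = letters s ++ β'
-- ('transition'); this is impossible only when β = [] while P rises and Q
-- falls, and that is precisely the step where both "Q ≥ P" and "X ≥ 0" fail.
-- Hence Q stays above P iff X stays non-negative ('belowIffNonneg').

module Submission where

open import Defs
open import Data.Nat using (ℕ)
open import Data.Product using (Σ)
open import Function.Definitions using (Bijective)
open import Relation.Binary.PropositionalEquality using (_≡_)

open import Data.Nat using (zero; suc)
import Data.Nat as ℕ
import Data.Nat.Properties as ℕP
open import Data.Integer using (ℤ; +_; _+_; _-_; _≤ᵇ_; -1ℤ)
import Data.Integer as ℤ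
open import Data.Integer.Properties
  using ( ≤⇒≤ᵇ; ≤ᵇ⇒≤; ≤-trans; ≤-antisym; i≤i+j; i≤j⇒0≤j-i
        ; i≡j⇒i-j≡0; i-j≡0⇒i≡j; +-injective)
open import Data.Integer.Tactic.RingSolver using (solve-∀)
open import Data.Bool using (Bool; true; false; _∧_; T)
open import Data.Bool.Properties using (T-∧; T-≡; T-irrelevant)
open import Data.Vec using (Vec; []; _∷_; zipWith; map)
import Data.Vec.Properties as VecP
open import Data.List using (List; []; _∷_; _++_; length)
open import Data.Nat.ListAction using (sum)
open import Data.Nat.ListAction.Properties using (sum-++)
import Data.List as List
open import Data.List.Properties using (++-assoc; length-++; map-++; ∷-injectiveʳ)
open import Data.List.Relation.Unary.All using (All; []; _∷_)
open import Data.Product using (_×_; _,_; proj₁; proj₂)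
open import Data.Sum using (_⊎_; inj₁; inj₂)
open import Data.Unit using (tt)
open import Data.Empty using (⊥-elim)
open import Function.Bundles using (Equivalence)
open import Function.Definitions using (Injective; Surjective)
open import Relation.Nullary using (¬_)
open import Relation.Binary.PropositionalEquality
  using (refl; sym; trans; cong; cong₂; subst; module ≡-Reasoning)

open Equivalence using (to; from)

not-T : ∀ {b} → ¬ T b → b ≡ false
not-T {false} _ = refl
not-T {true} ¬t = ⊥-elim (¬t tt)

≟S-sound : ∀ x y → T (x ≟S y) → x ≡ y
≟S-sound U U _ = refl
≟S-sound D D _ = refl
≟S-sound E E _ = refl
≟S-sound U D ()
≟S-sound U E ()
≟S-sound D U ()
≟S-sound D E ()
≟S-sound E U ()
≟S-sound E D ()

≟S-refl : ∀ x → T (x ≟S x)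
≟S-refl U = tt
≟S-refl D = tt
≟S-refl E = tt

eqListᵇ-sound : ∀ a b → T (eqListᵇ a b) → a ≡ b
eqListᵇ-sound [] [] _ = refl
eqListᵇ-sound [] (_ ∷ _) ()
eqListᵇ-sound (_ ∷ _) [] ()
eqListᵇ-sound (x ∷ a) (y ∷ b) t =
  let (x≟y , a≟b) = to T-∧ t in cong₂ _∷_ (≟S-sound x y x≟y) (eqListᵇ-sound a b a≟b)

eqListᵇ-refl : ∀ a → T (eqListᵇ a a)
eqListᵇ-refl [] = tt
eqListᵇ-refl (x ∷ a) = from T-∧ (≟S-refl x , eqListᵇ-refl a)

subtype-≡ : ∀ {A : Set} {b : A → Bool} {x y : Σ A (λ a → T (b a))} →
  proj₁ x ≡ proj₁ y → x ≡ y
subtype-≡ {x = a , t} {y = .a , t'} refl = cong (a ,_) (T-irrelevant t t')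

pairs-≡ : ∀ {n} {b : M n × M n → Bool} {x y : Σ (M n × M n) (λ pq → T (b pq))} →
  proj₁ (proj₁ (proj₁ x)) ≡ proj₁ (proj₁ (proj₁ y)) →
  proj₁ (proj₂ (proj₁ x)) ≡ proj₁ (proj₂ (proj₁ y)) → x ≡ y
pairs-≡ e₁ e₂ = subtype-≡ (cong₂ _,_ (subtype-≡ e₁) (subtype-≡ e₂))

Letter : Step → Set
Letter s = supp s ≡ u

letters : Step → List Step
letters U = U ∷ []
letters E = E ∷ []
letters D = []

cl-∷ : ∀ {n} s (w : Word n) → cl (s ∷ w) ≡ letters s ++ cl w
cl-∷ U w = refl
cl-∷ D w = refl
cl-∷ E w = refl

cl-letter : ∀ {n} {c} (w : Word n) → Letter c → cl (c ∷ w) ≡ c ∷ cl w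
cl-letter {c = U} w refl = refl
cl-letter {c = E} w refl = refl
cl-letter {c = D} w ()

letters-of-cl : ∀ {n} (w : Word n) → All Letter (cl w)
letters-of-cl [] = []
letters-of-cl (U ∷ w) = refl ∷ letters-of-cl w
letters-of-cl (E ∷ w) = refl ∷ letters-of-cl w
letters-of-cl (D ∷ w) = letters-of-cl w

-- The weight of a class word: a U weighs 2 and an E weighs 1, so that every
-- step rises by the weight of its letters minus one.
κ : Step → ℕ
κ U = 2
κ E = 1
κ D = 0

weight : List Step → ℕ
weight a = sum (List.map κ a)

weight-++ : ∀ a b → weight (a ++ b) ≡ weight a ℕ.+ weight b
weight-++ a b = trans (cong sum (map-++ κ a b)) (sum-++ (List.map κ a) (List.map κ b))

δ-weight : ∀ s → δ s ≡ + weight (letters s) - + 1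
δ-weight U = refl
δ-weight E = refl
δ-weight D = refl

sub-+-sub : ∀ (a b c d : ℤ) → (a - b) + (c - d) ≡ (a + c) - (b + d)
sub-+-sub = solve-∀

exchange : ∀ (h a b c e : ℤ) → a + b ≡ c + e → (h + a) + (b - c) ≡ h + e
exchange h a b c e ab≡ce = begin
  (h + a) + (b - c)  ≡⟨ regroupˡ h a b c ⟩
  h + (a + b) - c    ≡⟨ cong (λ z → h + z - c) ab≡ce ⟩
  h + (c + e) - c    ≡⟨ regroupʳ h c e ⟩
  h + e              ∎
  where
  open ≡-Reasoning
  regroupˡ : ∀ (h a b c : ℤ) → (h + a) + (b - c) ≡ h + (a + b) - c
  regroupˡ = solve-∀
  regroupʳ : ∀ (h c e : ℤ) → h + (c + e) - c ≡ h + e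
  regroupʳ = solve-∀

nonnegᵇ : ∀ {n} → ℤ → Word n → Bool
nonnegᵇ h w = allV (λ k → + 0 ≤ᵇ k) (heightsFrom h w)

belowᵇ : ∀ {n} → ℤ → ℤ → Word n → Word n → Bool
belowᵇ hp hq p q = allV (λ b → b) (zipWith _≤ᵇ_ (heightsFrom hp p) (heightsFrom hq q))

motzkin-intro : ∀ {n} (w : Word n) → T (nonnegᵇ (+ 0) w) → finalHeight w ≡ + 0 → IsMotzkin w
motzkin-intro w nonneg ends rewrite ends = from T-∧ (nonneg , tt)

motzkin-nonneg : ∀ {n} (w : Word n) → IsMotzkin w → T (nonnegᵇ (+ 0) w)
motzkin-nonneg w m = proj₁ (to T-∧ m)

motzkin-final : ∀ {n} (w : Word n) → IsMotzkin w → finalHeight w ≡ + 0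
motzkin-final w m =
  let (≤0 , 0≤) = to T-∧ (proj₂ (to (T-∧ {nonnegᵇ (+ 0) w}) m))
  in ≤-antisym (≤ᵇ⇒≤ ≤0) (≤ᵇ⇒≤ 0≤)

nonneg-below : ∀ {n} hp hq (p q : Word n) →
  T (nonnegᵇ hp p) → T (belowᵇ hp hq p q) → T (nonnegᵇ hq q)
nonneg-below hp hq [] [] _ _ = tt
nonneg-below hp hq (s ∷ p) (t ∷ q) nonneg below =
  let (0≤p , nonneg′) = to T-∧ nonneg
      (p≤q , below′)  = to T-∧ below
      0≤q = ≤-trans (≤ᵇ⇒≤ {+ 0} {hp + δ s} 0≤p) (≤ᵇ⇒≤ {hp + δ s} {hq + δ t} p≤q)
  in from T-∧ (≤⇒≤ᵇ 0≤q , nonneg-below (hp + δ s) (hq + δ t) p q nonneg′ below′)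

finalHeight-weight : ∀ {n} (w : Word n) → finalHeight w ≡ + weight (cl w) - + n
finalHeight-weight [] = refl
finalHeight-weight {suc n} (s ∷ w) = begin
  δ s + finalHeight w
    ≡⟨ cong₂ _+_ (δ-weight s) (finalHeight-weight w) ⟩
  (+ weight (letters s) - + 1) + (+ weight (cl w) - + n)
    ≡⟨ sub-+-sub (+ weight (letters s)) (+ 1) (+ weight (cl w)) (+ n) ⟩
  + (weight (letters s) ℕ.+ weight (cl w)) - + suc n
    ≡⟨ cong (λ k → + k - + suc n) (sym (weight-cl s w)) ⟩
  + weight (cl (s ∷ w)) - + suc n ∎
  where
  open ≡-Reasoning
  weight-cl : ∀ {m} s (w : Word m) → weight (cl (s ∷ w)) ≡ weight (letters s) ℕ.+ weight (cl w)
  weight-cl s w = trans (cong weight (cl-∷ s w)) (weight-++ (letters s) (cl w))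

sameFinalHeight : ∀ {n} (p q : Word n) → cl p ≡ cl q → finalHeight p ≡ finalHeight q
sameFinalHeight {n} p q classes =
  trans (finalHeight-weight p) (trans (cong (λ c → + weight c - + n) classes) (sym (finalHeight-weight q)))

δ-xLetter : ∀ s t → δ (xLetter s t) ≡ + length (letters t) - + length (letters s)
δ-xLetter U U = refl
δ-xLetter U E = refl
δ-xLetter U D = refl
δ-xLetter E U = refl
δ-xLetter E E = refl
δ-xLetter E D = refl
δ-xLetter D U = refl
δ-xLetter D E = refl
δ-xLetter D D = refl

allowed-letter : ∀ s t → T (allowedᵇ (xLetter s t) s)
allowed-letter U U = tt
allowed-letter U E = tt
allowed-letter U D = tt
allowed-letter E U = tt
allowed-letter E E = tt
allowed-letter E D = tt
allowed-letter D U = tt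
allowed-letter D E = tt
allowed-letter D D = tt

allowed-φ : ∀ {n} (p q : Word n) → T (allowedWᵇ (zipWith xLetter p q) p)
allowed-φ [] [] = tt
allowed-φ (s ∷ p) (t ∷ q) = from T-∧ (allowed-letter s t , allowed-φ p q)

recoverSupp : Step → Step → Supp
recoverSupp D U = u
recoverSupp D _ = d
recoverSupp _ D = d
recoverSupp _ _ = u

recover-supp : ∀ s t → recoverSupp s (xLetter s t) ≡ supp t
recover-supp U U = refl
recover-supp U E = refl
recover-supp U D = refl
recover-supp E U = refl
recover-supp E E = refl
recover-supp E D = refl
recover-supp D U = refl
recover-supp D E = refl
recover-supp D D = refl

supp-recover : ∀ {n} (p q : Word n) → map supp q ≡ zipWith recoverSupp p (zipWith xLetter p q)
supp-recover [] [] = refl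
supp-recover (s ∷ p) (t ∷ q) = cong₂ _∷_ (sym (recover-supp s t)) (supp-recover p q)

rep : Supp → Step
rep u = E
rep d = D

xLetter-supp : ∀ s t → xLetter s t ≡ xLetter s (rep (supp t))
xLetter-supp U U = refl
xLetter-supp U E = refl
xLetter-supp U D = refl
xLetter-supp E U = refl
xLetter-supp E E = refl
xLetter-supp E D = refl
xLetter-supp D U = refl
xLetter-supp D E = refl
xLetter-supp D D = refl

decode-letter : ∀ x s → T (allowedᵇ x s) → xLetter s (rep (recoverSupp s x)) ≡ x
decode-letter D E _ = refl
decode-letter D U _ = refl
decode-letter E D _ = refl
decode-letter E E _ = refl
decode-letter E U _ = refl
decode-letter U D _ = refl
decode-letter D D ()
decode-letter U U ()
decode-letter U E ()

zip-decode : ∀ {n} (x p q : Word n) → T (allowedWᵇ x p) →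
  map supp q ≡ zipWith recoverSupp p x → zipWith xLetter p q ≡ x
zip-decode [] [] [] _ _ = refl
zip-decode (x ∷ xs) (s ∷ p) (t ∷ q) allowed supports =
  let (allowed-x , allowed-xs) = to T-∧ allowed
      (supp-t , supp-q)        = VecP.∷-injective supports
      decode-x = begin
        xLetter s t                        ≡⟨ xLetter-supp s t ⟩
        xLetter s (rep (supp t))           ≡⟨ cong (λ σ → xLetter s (rep σ)) supp-t ⟩
        xLetter s (rep (recoverSupp s x))  ≡⟨ decode-letter x s allowed-x ⟩
        x                                  ∎
  in cong₂ _∷_ decode-x (zip-decode xs p q allowed-xs supp-q)
  where open ≡-Reasoning

finalHeight-φ : ∀ {n} (p q : Word n) →
  finalHeight (zipWith xLetter p q) ≡ + length (cl q) - + length (cl p)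
finalHeight-φ [] [] = refl
finalHeight-φ (s ∷ p) (t ∷ q) = begin
  δ (xLetter s t) + finalHeight (zipWith xLetter p q)
    ≡⟨ cong₂ _+_ (δ-xLetter s t) (finalHeight-φ p q) ⟩
  (+ length (letters t) - + length (letters s)) + (+ length (cl q) - + length (cl p))
    ≡⟨ sub-+-sub (+ length (letters t)) (+ length (letters s)) (+ length (cl q)) (+ length (cl p)) ⟩
  + (length (letters t) ℕ.+ length (cl q)) - + (length (letters s) ℕ.+ length (cl p))
    ≡⟨ cong₂ (λ i j → + i - + j) (sym (length-cl t q)) (sym (length-cl s p)) ⟩
  + length (cl (t ∷ q)) - + length (cl (s ∷ p)) ∎
  where
  open ≡-Reasoning
  length-cl : ∀ {m} s (w : Word m) → length (cl (s ∷ w)) ≡ length (letters s) ℕ.+ length (cl w)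
  length-cl s w = trans (cong length (cl-∷ s w)) (length-++ (letters s))

-- P takes step s and Q takes step t: Q appends its letter, P removes its own.
record Transition (β : List Step) (s t : Step) (β' : List Step) : Set where
  constructor queued
  field update : β ++ letters t ≡ letters s ++ β'

-- The only steps with no transition: the queue is empty, P rises, Q falls.
data Blocked : Step → Step → List Step → Set where
  U-over-D : Blocked U D []
  E-over-D : Blocked E D []

transition : ∀ s t β r r' → letters s ++ r ≡ β ++ letters t ++ r' →
  Blocked s t β ⊎ Σ (List Step) λ β' → Transition β s t β' × r ≡ β' ++ r'
transition D t β r r' classes =
  inj₂ (β ++ letters t , queued refl , trans classes (sym (++-assoc β (letters t) r')))
transition U D [] r r' _ = inj₁ U-over-D
transition E D [] r r' _ = inj₁ E-over-D
transition U U [] r r' classes = inj₂ ([] , queued refl , ∷-injectiveʳ classes)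
transition E E [] r r' classes = inj₂ ([] , queued refl , ∷-injectiveʳ classes)
transition U E [] r r' ()
transition E U [] r r' ()
transition U t (_ ∷ β) _ r' refl =
  inj₂ (β ++ letters t , queued refl , sym (++-assoc β (letters t) r'))
transition E t (_ ∷ β) _ r' refl =
  inj₂ (β ++ letters t , queued refl , sym (++-assoc β (letters t) r'))

balance : ∀ {β s t β'} (f : List Step → ℕ) → (∀ a b → f (a ++ b) ≡ f a ℕ.+ f b) →
  Transition β s t β' → f β ℕ.+ f (letters t) ≡ f (letters s) ℕ.+ f β'
balance {β} {s} {t} {β'} f additive step =
  trans (sym (additive β (letters t))) (trans (cong f (Transition.update step)) (additive (letters s) β'))

height-step : ∀ {β s t β'} hp hq → hq ≡ hp + + weight β → Transition β s t β' →
  hq + δ t ≡ (hp + δ s) + + weight β'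
height-step {β} {s} {t} {β'} hp _ refl step = begin
  (hp + + weight β) + δ t
    ≡⟨ cong (_+_ (hp + + weight β)) (δ-weight t) ⟩
  (hp + + weight β) + (+ weight (letters t) - + 1)
    ≡⟨ regroup hp (+ weight β) (+ weight (letters t)) (+ weight (letters s)) ⟩
  ((hp + (+ weight (letters s) - + 1)) + + weight β) + (+ weight (letters t) - + weight (letters s))
    ≡⟨ cong (λ z → ((hp + z) + + weight β) + (+ weight (letters t) - + weight (letters s)))
            (sym (δ-weight s)) ⟩
  ((hp + δ s) + + weight β) + (+ weight (letters t) - + weight (letters s))
    ≡⟨ exchange (hp + δ s) (+ weight β) (+ weight (letters t)) (+ weight (letters s)) (+ weight β')
                (cong +_ (balance weight weight-++ step)) ⟩
  (hp + δ s) + + weight β' ∎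
  where
  open ≡-Reasoning
  regroup : ∀ (h a b c : ℤ) → (h + a) + (b - + 1) ≡ ((h + (c - + 1)) + a) + (b - c)
  regroup = solve-∀

level-step : ∀ {β s t β'} → Transition β s t β' → + length β + δ (xLetter s t) ≡ + length β'
level-step {β} {s} {t} {β'} step =
  trans (cong (_+_ (+ length β)) (δ-xLetter s t))
        (exchange (+ 0) (+ length β) (+ length (letters t)) (+ length (letters s)) (+ length β')
                  (cong +_ (balance length (λ a b → length-++ a) step)))

rise-over-fall : ∀ h k → ¬ T (h + + k ≤ᵇ (h + + 0) + -1ℤ)
rise-over-fall h k le =
  negative k (subst (ℤ._≤_ (+ 0)) (gap h (+ k)) (i≤j⇒0≤j-i P≤Q))
  where
  P≤Q : h + + k ℤ.≤ (h + + 0) + -1ℤ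
  P≤Q = ≤ᵇ⇒≤ {h + + k} {(h + + 0) + -1ℤ} le
  gap : ∀ (h k : ℤ) → ((h + + 0) + -1ℤ) - (h + k) ≡ -1ℤ - k
  gap = solve-∀
  negative : ∀ k → ¬ (+ 0 ℤ.≤ -1ℤ - + k)
  negative zero ()
  negative (suc k) ()

blocked-below : ∀ {s t β} hp hq → Blocked s t β → hq ≡ hp + + weight β →
  (hp + δ s ≤ᵇ hq + δ t) ≡ false
blocked-below hp _ U-over-D refl = not-T (rise-over-fall hp 1)
blocked-below hp _ E-over-D refl = not-T (rise-over-fall hp 0)

belowIffNonneg : ∀ {m} (p q : Word m) (β : List Step) (hp hq : ℤ) →
  cl p ≡ β ++ cl q → hq ≡ hp + + weight β →
  belowᵇ hp hq p q ≡ nonnegᵇ (+ length β) (zipWith xLetter p q)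
belowIffNonneg [] [] β hp hq _ _ = refl
belowIffNonneg (s ∷ p) (t ∷ q) β hp hq classes gap
  with transition s t β (cl p) (cl q) (trans (sym (cl-∷ s p)) (trans classes (cong (β ++_) (cl-∷ t q))))
... | inj₁ U-over-D = cong (_∧ belowᵇ (hp + δ U) (hq + δ D) p q) (blocked-below hp hq U-over-D gap)
... | inj₁ E-over-D = cong (_∧ belowᵇ (hp + δ E) (hq + δ D) p q) (blocked-below hp hq E-over-D gap)
... | inj₂ (β' , step , classes′) = cong₂ _∧_ heads tails
  where
  gap′ : hq + δ t ≡ (hp + δ s) + + weight β'
  gap′ = height-step hp hq gap step
  Q-above : T (hp + δ s ≤ᵇ (hp + δ s) + + weight β')
  Q-above = ≤⇒≤ᵇ (i≤i+j (hp + δ s) (+ weight β'))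
  heads : (hp + δ s ≤ᵇ hq + δ t) ≡ (+ 0 ≤ᵇ + length β + δ (xLetter s t))
  heads = trans (to T-≡ (subst (λ h → T (hp + δ s ≤ᵇ h)) (sym gap′) Q-above))
                (sym (cong (+ 0 ≤ᵇ_) (level-step step)))
  tails : belowᵇ (hp + δ s) (hq + δ t) p q ≡
          nonnegᵇ (+ length β + δ (xLetter s t)) (zipWith xLetter p q)
  tails = trans (belowIffNonneg p q β' (hp + δ s) (hq + δ t) classes′ gap′)
                (cong (λ h → nonnegᵇ h (zipWith xLetter p q)) (sym (level-step step)))

word-determined : ∀ {n} (q q' : Word n) → map supp q ≡ map supp q' → cl q ≡ cl q' → q ≡ q'
word-determined [] [] _ _ = refl
word-determined (D ∷ q) (D ∷ q') supports classes =
  cong (D ∷_) (word-determined q q' (VecP.∷-injectiveʳ supports) classes)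
word-determined (U ∷ q) (U ∷ q') supports classes =
  cong (U ∷_) (word-determined q q' (VecP.∷-injectiveʳ supports) (∷-injectiveʳ classes))
word-determined (E ∷ q) (E ∷ q') supports classes =
  cong (E ∷_) (word-determined q q' (VecP.∷-injectiveʳ supports) (∷-injectiveʳ classes))
word-determined (U ∷ q) (E ∷ q') _ ()
word-determined (E ∷ q) (U ∷ q') _ ()
word-determined (D ∷ q) (U ∷ q') () _
word-determined (D ∷ q) (E ∷ q') () _
word-determined (U ∷ q) (D ∷ q') () _
word-determined (E ∷ q) (D ∷ q') () _

fill : ∀ {n} → Vec Supp n → List Step → Word n
fill [] _ = []
fill (d ∷ σ) ℓ = D ∷ fill σ ℓ
fill (u ∷ σ) [] = E ∷ fill σ []
fill (u ∷ σ) (c ∷ ℓ) = c ∷ fill σ ℓ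

fill-supp : ∀ {n} (σ : Vec Supp n) {ℓ} → All Letter ℓ → map supp (fill σ ℓ) ≡ σ
fill-supp [] _ = refl
fill-supp (d ∷ σ) letters-ℓ = cong (d ∷_) (fill-supp σ letters-ℓ)
fill-supp (u ∷ σ) [] = cong (u ∷_) (fill-supp σ [])
fill-supp (u ∷ σ) (letter-c ∷ letters-ℓ) = cong₂ _∷_ letter-c (fill-supp σ letters-ℓ)

cl-fill : ∀ {n} (σ : Vec Supp n) {ℓ} → All Letter ℓ →
  length (cl (fill σ ℓ)) ≡ length ℓ → cl (fill σ ℓ) ≡ ℓ
cl-fill [] [] _ = refl
cl-fill [] (_ ∷ _) ()
cl-fill (d ∷ σ) letters-ℓ same = cl-fill σ letters-ℓ same
cl-fill (u ∷ σ) [] ()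
cl-fill (u ∷ σ) {c ∷ ℓ} (letter-c ∷ letters-ℓ) same =
  trans head-letter (cong (c ∷_) (cl-fill σ letters-ℓ (ℕP.suc-injective same′)))
  where
  head-letter : cl (c ∷ fill σ ℓ) ≡ c ∷ cl (fill σ ℓ)
  head-letter = cl-letter (fill σ ℓ) letter-c
  same′ : suc (length (cl (fill σ ℓ))) ≡ suc (length ℓ)
  same′ = trans (sym (cong length head-letter)) same

≤C-class : ∀ {n} (p q : Word n) → p ≤C q → cl p ≡ cl q
≤C-class p q p≤q = eqListᵇ-sound (cl p) (cl q) (proj₁ (to T-∧ p≤q))

≤C-below : ∀ {n} (p q : Word n) → p ≤C q → T (leqSᵇ p q)
≤C-below p q p≤q = proj₂ (to T-∧ p≤q)

≤C-intro : ∀ {n} (p q : Word n) → cl p ≡ cl q → T (leqSᵇ p q) → p ≤C q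
≤C-intro p q classes below =
  from T-∧ (subst (λ c → T (eqListᵇ (cl p) c)) classes (eqListᵇ-refl (cl p)) , below)

-- X = φ(P,Q) is a Motzkin path: non-negative by the queue argument, and it
-- ends at |cl Q| − |cl P| = 0.
wellDefined : ∀ n → WellDefined n
wellDefined n (((P , motzkin-P) , (Q , _)) , P≤Q) =
  (((X , motzkin-X) , (P , motzkin-P)) , allowed-φ P Q) , refl
  where
  X : Word n
  X = zipWith xLetter P Q
  classes : cl P ≡ cl Q
  classes = ≤C-class P Q P≤Q
  motzkin-X : IsMotzkin X
  motzkin-X = motzkin-intro X
    (subst T (belowIffNonneg P Q [] (+ 0) (+ 0) classes refl) (≤C-below P Q P≤Q))
    (trans (finalHeight-φ P Q) (i≡j⇒i-j≡0 (cong (λ c → + length c) (sym classes))))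

-- P is the second component, and Q is recovered from its support and class.
injective : ∀ n → Injective _≡_ _≡_ (φ (wellDefined n))
injective n {((P , _) , (Q , _)) , P≤Q} {((P' , _) , (Q' , _)) , P'≤Q'} same =
  pairs-≡ sameP (word-determined Q Q' supports classes)
  where
  sameP : P ≡ P'
  sameP = cong (λ z → proj₁ (proj₂ (proj₁ z))) same
  sameX : zipWith xLetter P Q ≡ zipWith xLetter P' Q'
  sameX = cong (λ z → proj₁ (proj₁ (proj₁ z))) same
  supports : map supp Q ≡ map supp Q'
  supports = trans (supp-recover P Q)
                   (trans (cong₂ (zipWith recoverSupp) sameP sameX) (sym (supp-recover P' Q')))
  classes : cl Q ≡ cl Q'
  classes = trans (sym (≤C-class P Q P≤Q)) (trans (cong cl sameP) (≤C-class P' Q' P'≤Q'))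

-- Q fills the support recovered from (P, X) with the letters of cl P.
surjective : ∀ n → Surjective _≡_ _≡_ (φ (wellDefined n))
surjective n (((X , motzkin-X) , (P , motzkin-P)) , allowed) =
  (((P , motzkin-P) , (Q , motzkin-Q)) , ≤C-intro P Q classes below) ,
  λ { refl → pairs-≡ decodes refl }
  where
  Q : Word n
  Q = fill (zipWith recoverSupp P X) (cl P)
  decodes : zipWith xLetter P Q ≡ X
  decodes = zip-decode X P Q allowed (fill-supp (zipWith recoverSupp P X) (letters-of-cl P))
  sameLength : length (cl Q) ≡ length (cl P)
  sameLength = +-injective (i-j≡0⇒i≡j _ _
    (trans (sym (finalHeight-φ P Q)) (trans (cong finalHeight decodes) (motzkin-final X motzkin-X))))
  classes : cl P ≡ cl Q
  classes = sym (cl-fill (zipWith recoverSupp P X) (letters-of-cl P) sameLength)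
  below : T (leqSᵇ P Q)
  below = subst T (sym (belowIffNonneg P Q [] (+ 0) (+ 0) classes refl))
                (subst (λ w → T (nonnegᵇ (+ 0) w)) (sym decodes) (motzkin-nonneg X motzkin-X))
  motzkin-Q : IsMotzkin Q
  motzkin-Q = motzkin-intro Q (nonneg-below (+ 0) (+ 0) P Q (motzkin-nonneg P motzkin-P) below)
                              (trans (sym (sameFinalHeight P Q classes)) (motzkin-final P motzkin-P))

theorem4p7 : (n : ℕ) → Σ (WellDefined n) λ wd → Bijective _≡_ _≡_ (φ wd)
theorem4p7 n = wellDefined n , injective n , surjective n
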